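{- Let $a>b$ be positive integers and $m,n$ positive integers with $\gcd(m,n)=2$. Assume there are $(a,b)$ knight's tours of $[m]\times[n]$, $[n]\times[n]$ and $[m]\times[m]$, each containing link H and link V. Then there is $K$ such that for all even $k,l\geq K$, the board $[k]\times[l]$ admits an $(a,b)$ knight's tour; moreover this tour can be chosen to contain link V.
   Context: $[m]=\{0,\dots,m-1\}$. The $(a,b)$ knight's graph on $[p]\times[q]$ has vertex set $[p]\times[q]$, with $(x,y)\sim(x',y')$ iff $\{|x-x'|,|y-y'|\}=\{a,b\}$; an $(a,b)$ knight's tour is a Hamiltonian cycle of it. Link H is the edge $\{(a-1,b),(a-b-1,a+b)\}$ together with all its images under the symmetries of the board; link V is the edge $\{(b,a-1),(a+b,a-b-1)\}$ together with its symmetric images. A tour contains a link if it contains such an edge. -}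

module Defs where

open import Data.Nat using (ℕ; zero; suc; _+_; _*_; _∸_; _≤_; _<_; ∣_-_∣)
open import Data.Product using (Σ; Σ-syntax; _×_; _,_; proj₁; proj₂)
open import Data.Sum using (_⊎_)
open import Data.Bool using (Bool; true; false; if_then_else_)
open import Relation.Binary.PropositionalEquality using (_≡_)

Sq : Set
Sq = ℕ × ℕ

OnBoard : ℕ → ℕ → Sq → Set
OnBoard p q (x , y) = x < p × y < q

Adj : ℕ → ℕ → Sq → Sq → Set
Adj a b (x , y) (x' , y') =
  (∣ x - x' ∣ ≡ a × ∣ y - y' ∣ ≡ b) ⊎ (∣ x - x' ∣ ≡ b × ∣ y - y' ∣ ≡ a)

-- An (a,b) knight's tour of [p]×[q]: a Hamiltonian cycle of the (a,b) knight's
-- graph, given as a cyclic enumeration pos 0, …, pos (p*q - 1) of all squares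
-- (injective on indices < p*q and landing on the board, hence a bijection onto
-- the board), consecutive squares adjacent, the last adjacent to the first.
-- A cycle needs at least 3 vertices.
record Tour (a b p q : ℕ) : Set where
  field
    atLeast3 : 3 ≤ p * q
    pos      : ℕ → Sq
    onBoard  : ∀ i → i < p * q → OnBoard p q (pos i)
    injective : ∀ i j → i < p * q → j < p * q → pos i ≡ pos j → i ≡ j
    step     : ∀ i → suc i < p * q → Adj a b (pos i) (pos (suc i))
    close    : Adj a b (pos (p * q ∸ 1)) (pos 0)

open Tour public

Consec : ∀ {a b p q} → Tour a b p q → Sq → Sq → Set
Consec {p = p} {q} t u v =
  (Σ[ i ∈ ℕ ] (suc i < p * q × pos t i ≡ u × pos t (suc i) ≡ v))
  ⊎ (pos t (p * q ∸ 1) ≡ u × pos t 0 ≡ v)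

HasEdge : ∀ {a b p q} → Tour a b p q → Sq → Sq → Set
HasEdge t u v = Consec t u v ⊎ Consec t v u

-- Symmetries of the board [p]×[q]: the reflections in the two axes (any
-- combination), and, when the board is square (p ≡ q), additionally composed
-- with the transposition (x,y) ↦ (y,x).  (The dihedral group of the board.)
data Sym (p q : ℕ) : Set where
  refl-only : Bool → Bool → Sym p q
  transp    : p ≡ q → Bool → Bool → Sym p q

flipIf : Bool → ℕ → ℕ → ℕ
flipIf f p x = if f then (p ∸ 1) ∸ x else x

act : ∀ {p q} → Sym p q → Sq → Sq
act {p} {q} (refl-only fx fy) (x , y) = flipIf fx p x , flipIf fy q y
act {p} {q} (transp _ fx fy) (x , y) = flipIf fx p y , flipIf fy q x

-- A tour contains the link generated by the edge {u , v} if the base edge lies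
-- on the board and the tour contains some image of it under a board symmetry.
-- (Requiring the base edge to lie on the board makes the truncated
-- subtraction in the reflections exact; symmetric images of off-board
-- squares are off-board anyway.)
HasLink : ∀ {a b p q} → Tour a b p q → Sq → Sq → Set
HasLink {p = p} {q} t u v =
  OnBoard p q u × OnBoard p q v × Σ[ s ∈ Sym p q ] HasEdge t (act s u) (act s v)

HasLinkH : ∀ {a b p q} → Tour a b p q → Set
HasLinkH {a} {b} t = HasLink t (a ∸ 1 , b) (a ∸ b ∸ 1 , a + b)

HasLinkV : ∀ {a b p q} → Tour a b p q → Set
HasLinkV {a} {b} t = HasLink t (b , a ∸ 1) (a + b , a ∸ b ∸ 1)

TourHV : ℕ → ℕ → ℕ → ℕ → Set
TourHV a b p q = Σ[ t ∈ Tour a b p q ] (HasLinkH t × HasLinkV t)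

-- Tours are glued side by side. In every tour a corner of the board is joined to both of its only two
-- neighbours, e.g. (0,0) to (b,a). Given a tour S of [p]×[q] containing a right-hand image A–B of link H
-- and a tour Q of [p′]×[q], delete A–B from S and the corner edge X–Y (reflected vertically like A–B)
-- from Q shifted right by p: then A–X and B–Y are knight moves, and the two paths close up to a tour of
-- [p+p′]×[q] that keeps every edge of Q away from its left columns, in particular its right-hand links.
-- Hence tours of widths m and n with right-hand images of both links yield such tours of every width
-- i m + j n, which, as gcd m n = 2, includes every large even width. Doing this for heights n and m,
-- transposing, and once more for the other side gives a tour of [l]×[k] with a right-hand link H, whose
-- transpose is a tour of [k]×[l] containing link V.

module Submission where

open import Defs
open import Data.Bool using (Bool; true; false)
open import Data.Empty using (⊥; ⊥-elim)
open import Data.Fin using (Fin; toℕ; fromℕ<; combine; punchOut)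
import Data.Fin.Properties as Fin
open import Data.List using (List; []; _∷_; _++_; map; length; reverse; applyUpTo; [_])
open import Data.List.Properties using (length-++; length-map; length-reverse; length-applyUpTo; unfold-reverse; reverse-involutive)
open import Data.List.Membership.Propositional using (_∈_)
open import Data.List.Membership.Propositional.Properties using (∈-map⁻)
open import Data.List.Relation.Binary.Permutation.Propositional using (↭-sym)
open import Data.List.Relation.Binary.Permutation.Propositional.Properties using (↭-reverse; All-resp-↭)
import Data.List.Relation.Binary.Permutation.Setoid as PermutationSetoid
import Data.List.Relation.Binary.Permutation.Setoid.Properties as PermutationSetoid
open import Data.List.Relation.Unary.All as All using (All; []; _∷_)
import Data.List.Relation.Unary.All.Properties as All
open import Data.List.Relation.Unary.AllPairs using (_∷_)
open import Data.List.Relation.Unary.Any using (here; there)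
open import Data.List.Relation.Unary.Unique.Propositional using (Unique)
import Data.List.Relation.Unary.Unique.Propositional.Properties as Unique
open import Data.Nat using (ℕ; zero; suc; _+_; _*_; _∸_; _≤_; _<_; z≤n; s≤s; ∣_-_∣; _<?_; NonZero)
open import Data.Nat.Properties
open import Data.Nat.DivMod using (_/_; _%_; m≡m%n+[m/n]*n; m%n<n)
open import Data.Nat.Divisibility using (_∣_; divides; ∣m+n∣m⇒∣n; ∣n⇒∣m*n; ∣-refl; ∣-antisym)
open import Data.Nat.GCD using (gcd; gcd-GCD; gcd[m,n]∣m; gcd[m,n]∣n; gcd-greatest; module Bézout)
open import Data.Nat.Tactic.RingSolver using (solve-∀)
open import Data.Product using (Σ; Σ-syntax; ∃-syntax; _×_; _,_; proj₁; proj₂; swap)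
open import Data.Sum using (_⊎_; inj₁; inj₂)
open import Function.Definitions using (Injective)
open import Relation.Nullary using (¬_; yes; no)
open import Relation.Binary.PropositionalEquality
  using (_≡_; _≢_; refl; sym; trans; cong; cong₂; subst; subst₂; setoid; module ≡-Reasoning)
open ≡-Reasoning

-- first, final and nth return the junk square (0 , 0) on the empty list and out of range.
first : List Sq → Sq
first [] = (0 , 0)
first (x ∷ _) = x

final : List Sq → Sq
final [] = (0 , 0)
final (x ∷ []) = x
final (x ∷ y ∷ xs) = final (y ∷ xs)

nth : List Sq → ℕ → Sq
nth [] _ = (0 , 0)
nth (x ∷ xs) zero = x
nth (x ∷ xs) (suc i) = nth xs i

data Consecutive (u v : Sq) : List Sq → Set where
  here  : ∀ {xs} → Consecutive u v (u ∷ v ∷ xs)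
  there : ∀ {x xs} → Consecutive u v xs → Consecutive u v (x ∷ xs)

Consecutive-++ˡ : ∀ {u v xs} ys → Consecutive u v xs → Consecutive u v (xs ++ ys)
Consecutive-++ˡ ys here = here
Consecutive-++ˡ ys (there h) = there (Consecutive-++ˡ ys h)

Consecutive-++ʳ : ∀ {u v ys} xs → Consecutive u v ys → Consecutive u v (xs ++ ys)
Consecutive-++ʳ [] h = h
Consecutive-++ʳ (x ∷ xs) h = there (Consecutive-++ʳ xs h)

Consecutive-join : ∀ x xs y ys → Consecutive (final (x ∷ xs)) y ((x ∷ xs) ++ y ∷ ys)
Consecutive-join x [] y ys = here
Consecutive-join x (x' ∷ xs) y ys = there (Consecutive-join x' xs y ys)

Consecutive-++⁻ : ∀ {u v} xs ys → Consecutive u v (xs ++ ys) →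
  Consecutive u v xs ⊎ Consecutive u v ys ⊎ (final xs ≡ u × first ys ≡ v)
Consecutive-++⁻ [] ys h = inj₂ (inj₁ h)
Consecutive-++⁻ (x ∷ []) [] h = inj₁ h
Consecutive-++⁻ (x ∷ []) (y ∷ ys) here = inj₂ (inj₂ (refl , refl))
Consecutive-++⁻ (x ∷ []) (y ∷ ys) (there h) = inj₂ (inj₁ h)
Consecutive-++⁻ (x ∷ x' ∷ xs) ys here = inj₁ here
Consecutive-++⁻ (x ∷ x' ∷ xs) ys (there h) with Consecutive-++⁻ (x' ∷ xs) ys h
... | inj₁ h' = inj₁ (there h')
... | inj₂ r = inj₂ r

Consecutive-map⁺ : ∀ {u v} (f : Sq → Sq) xs → Consecutive u v xs → Consecutive (f u) (f v) (map f xs)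
Consecutive-map⁺ f (u ∷ v ∷ xs) here = here
Consecutive-map⁺ f (x ∷ xs) (there h) = there (Consecutive-map⁺ f xs h)

Consecutive-map⁻ : ∀ {u v} (f : Sq → Sq) xs → Consecutive u v (map f xs) →
  Σ[ u' ∈ Sq ] Σ[ v' ∈ Sq ] (Consecutive u' v' xs × u ≡ f u' × v ≡ f v')
Consecutive-map⁻ f (x ∷ y ∷ xs) here = x , y , here , refl , refl
Consecutive-map⁻ f (x ∷ xs) (there h) with Consecutive-map⁻ f xs h
... | u' , v' , h' , e₁ , e₂ = u' , v' , there h' , e₁ , e₂

final-++ : ∀ xs (y : Sq) ys → final (xs ++ y ∷ ys) ≡ final (y ∷ ys)
final-++ [] y ys = refl
final-++ (x ∷ []) y ys = refl
final-++ (x ∷ x' ∷ xs) y ys = final-++ (x' ∷ xs) y ys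

final-++′ : ∀ xs ys → ys ≢ [] → final (xs ++ ys) ≡ final ys
final-++′ xs [] ne = ⊥-elim (ne refl)
final-++′ xs (y ∷ ys) ne = final-++ xs y ys

final-∷ʳ : ∀ xs (z : Sq) → final (xs ++ [ z ]) ≡ z
final-∷ʳ xs z = final-++ xs z []

Consecutive-reverse : ∀ {u v} xs → Consecutive u v xs → Consecutive v u (reverse xs)
Consecutive-reverse {u} {v} (u ∷ v ∷ xs) here
  rewrite unfold-reverse u (v ∷ xs) | unfold-reverse v xs =
  subst (λ w → Consecutive w u ((reverse xs ++ [ v ]) ++ [ u ]))
    (final-∷ʳ (reverse xs) v) (join (reverse xs))
  where
  join : ∀ ys → Consecutive (final (ys ++ [ v ])) u ((ys ++ [ v ]) ++ [ u ])
  join [] = here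
  join (y ∷ ys) = Consecutive-join y (ys ++ [ v ]) u []
Consecutive-reverse (x ∷ xs) (there h) rewrite unfold-reverse x xs =
  Consecutive-++ˡ [ x ] (Consecutive-reverse xs h)

Consecutive-reverse⁻ : ∀ {u v} xs → Consecutive u v (reverse xs) → Consecutive v u xs
Consecutive-reverse⁻ xs h = subst (Consecutive _ _) (reverse-involutive xs) (Consecutive-reverse (reverse xs) h)

final-reverse : ∀ xs → final (reverse xs) ≡ first xs
final-reverse [] = refl
final-reverse (x ∷ xs) = trans (cong final (unfold-reverse x xs)) (final-∷ʳ (reverse xs) x)

first-reverse : ∀ xs → first (reverse xs) ≡ final xs
first-reverse xs = trans (sym (final-reverse (reverse xs))) (cong final (reverse-involutive xs))

first-map : ∀ (f : Sq → Sq) xs → xs ≢ [] → first (map f xs) ≡ f (first xs)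
first-map f [] ne = ⊥-elim (ne refl)
first-map f (x ∷ xs) ne = refl

final-map : ∀ (f : Sq → Sq) xs → xs ≢ [] → final (map f xs) ≡ f (final xs)
final-map f [] ne = ⊥-elim (ne refl)
final-map f (x ∷ []) ne = refl
final-map f (x ∷ y ∷ xs) ne = final-map f (y ∷ xs) (λ ())

map≢[] : ∀ (f : Sq → Sq) {xs} → xs ≢ [] → map f xs ≢ []
map≢[] f {[]} ne = ne
map≢[] f {x ∷ xs} ne = λ ()

first-++ : ∀ xs ys → xs ≢ [] → first (xs ++ ys) ≡ first xs
first-++ [] ys ne = ⊥-elim (ne refl)
first-++ (x ∷ xs) ys ne = refl

final-applyUpTo : ∀ (g : ℕ → Sq) n → final (applyUpTo g (suc n)) ≡ g n
final-applyUpTo g zero = refl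
final-applyUpTo g (suc n) = final-applyUpTo (λ k → g (suc k)) n

Consecutive-applyUpTo⁺ : ∀ (g : ℕ → Sq) n k → suc k < n → Consecutive (g k) (g (suc k)) (applyUpTo g n)
Consecutive-applyUpTo⁺ g (suc (suc n)) zero _ = here
Consecutive-applyUpTo⁺ g (suc n) (suc k) (s≤s lt) = there (Consecutive-applyUpTo⁺ (λ i → g (suc i)) n k lt)

Consecutive-applyUpTo⁻ : ∀ {u v} (g : ℕ → Sq) n → Consecutive u v (applyUpTo g n) →
  Σ[ k ∈ ℕ ] (suc k < n × u ≡ g k × v ≡ g (suc k))
Consecutive-applyUpTo⁻ g (suc (suc n)) here = 0 , s≤s (s≤s z≤n) , refl , refl
Consecutive-applyUpTo⁻ g (suc n) (there h) with Consecutive-applyUpTo⁻ (λ i → g (suc i)) n h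
... | k , lt , e₁ , e₂ = suc k , s≤s lt , e₁ , e₂

Unique-reverse : ∀ (xs : List Sq) → Unique xs → Unique (reverse xs)
Unique-reverse xs =
  PermutationSetoid.Unique-resp-↭ (setoid Sq) (PermutationSetoid.↭-sym (setoid Sq) (PermutationSetoid.↭-reverse (setoid Sq) xs))

All-reverse : ∀ {P : Sq → Set} xs → All P xs → All P (reverse xs)
All-reverse xs = All-resp-↭ (↭-sym (↭-reverse xs))

Unique-applyUpTo : ∀ (g : ℕ → Sq) n → (∀ i j → i < n → j < n → g i ≡ g j → i ≡ j) → Unique (applyUpTo g n)
Unique-applyUpTo g n inj = Unique.applyUpTo⁺₁ g n
  (λ {i} {j} i<j j<n e → <⇒≢ i<j (inj i j (<-trans i<j j<n) j<n e))

nth-∈ : ∀ xs i → i < length xs → nth xs i ∈ xs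
nth-∈ (x ∷ xs) zero _ = here refl
nth-∈ (x ∷ xs) (suc i) (s≤s lt) = there (nth-∈ xs i lt)

nth-injective : ∀ xs → Unique xs → ∀ i j → i < length xs → j < length xs → nth xs i ≡ nth xs j → i ≡ j
nth-injective (x ∷ xs) u zero zero _ _ _ = refl
nth-injective (x ∷ xs) (x∉ ∷ _) zero (suc j) _ (s≤s lj) e = ⊥-elim (All.lookup x∉ (nth-∈ xs j lj) e)
nth-injective (x ∷ xs) (x∉ ∷ _) (suc i) zero (s≤s li) _ e = ⊥-elim (All.lookup x∉ (nth-∈ xs i li) (sym e))
nth-injective (x ∷ xs) (_ ∷ u) (suc i) (suc j) (s≤s li) (s≤s lj) e = cong suc (nth-injective xs u i j li lj e)

nth-Consecutive : ∀ xs i → suc i < length xs → Consecutive (nth xs i) (nth xs (suc i)) xs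
nth-Consecutive (x ∷ y ∷ xs) zero _ = here
nth-Consecutive (x ∷ xs) (suc i) (s≤s lt) = there (nth-Consecutive xs i lt)

Consecutive-nth : ∀ {u v} xs → Consecutive u v xs →
  Σ[ i ∈ ℕ ] (suc i < length xs × nth xs i ≡ u × nth xs (suc i) ≡ v)
Consecutive-nth (u ∷ v ∷ xs) here = 0 , s≤s (s≤s z≤n) , refl , refl
Consecutive-nth (x ∷ xs) (there h) with Consecutive-nth xs h
... | i , lt , e₁ , e₂ = suc i , s≤s lt , e₁ , e₂

nth-final : ∀ xs n → length xs ≡ suc n → nth xs n ≡ final xs
nth-final (x ∷ []) zero _ = refl
nth-final (x ∷ y ∷ xs) (suc n) e = nth-final (y ∷ xs) n (suc-injective e)

nth-first : ∀ xs → nth xs 0 ≡ first xs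
nth-first [] = refl
nth-first (x ∷ xs) = refl

Consecutive-split : ∀ {u v} ws → Consecutive u v ws →
  Σ[ x ∈ Sq ] Σ[ xs ∈ List Sq ] Σ[ ys ∈ List Sq ] (ws ≡ (x ∷ xs) ++ v ∷ ys × final (x ∷ xs) ≡ u)
Consecutive-split (u ∷ v ∷ ys) here = u , [] , ys , refl , refl
Consecutive-split (w ∷ ws) (there h) with Consecutive-split ws h
... | x , xs , ys , refl , e = w , x ∷ xs , ys , refl , e

record ListCycle (a b p q : ℕ) : Set where
  field
    squares          : List Sq
    squares-length   : length squares ≡ p * q
    size≥3           : 3 ≤ p * q
    squares-unique   : Unique squares
    squares-onBoard  : All (OnBoard p q) squares
    squares-adjacent : ∀ {u v} → Consecutive u v squares → Adj a b u v
    closing-adjacent : Adj a b (final squares) (first squares)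

open ListCycle

CycleEdge : List Sq → Sq → Sq → Set
CycleEdge ws u v = Consecutive u v ws ⊎ (final ws ≡ u × first ws ≡ v)

module _ {a b p q : ℕ} (c : ListCycle a b p q) where
  private
    ws : List Sq
    ws = squares c
    N : ℕ
    N = p * q
    <N⇒<length : ∀ {i} → i < N → i < length ws
    <N⇒<length {i} = subst (i <_) (sym (squares-length c))
    length≡suc : length ws ≡ suc (N ∸ 1)
    length≡suc = trans (squares-length c) (sym (m+[n∸m]≡n {1} {N} (≤-trans (s≤s z≤n) (size≥3 c))))

  toTour : Tour a b p q
  toTour = record
    { atLeast3 = size≥3 c
    ; pos = nth ws
    ; onBoard = λ i lt → All.lookup (squares-onBoard c) (nth-∈ ws i (<N⇒<length lt))
    ; injective = λ i j li lj → nth-injective ws (squares-unique c) i j (<N⇒<length li) (<N⇒<length lj)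
    ; step = λ i lt → squares-adjacent c (nth-Consecutive ws i (<N⇒<length lt))
    ; close = subst₂ (Adj a b) (sym (nth-final ws (N ∸ 1) length≡suc)) (sym (nth-first ws)) (closing-adjacent c)
    }

  Consecutive⇒Consec : ∀ {u v} → Consecutive u v ws → Consec toTour u v
  Consecutive⇒Consec h with Consecutive-nth ws h
  ... | i , lt , e₁ , e₂ = inj₁ (i , subst (suc i <_) (squares-length c) lt , e₁ , e₂)

module _ {a b p q : ℕ} (t : Tour a b p q) where
  private
    N : ℕ
    N = p * q
    M : ℕ
    M = N ∸ 1
    N≡1+M : N ≡ suc M
    N≡1+M = sym (m+[n∸m]≡n {1} {N} (≤-trans (s≤s z≤n) (atLeast3 t)))
    ws : List Sq
    ws = applyUpTo (pos t) N
    ws≡ : ws ≡ applyUpTo (pos t) (suc M)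
    ws≡ = cong (applyUpTo (pos t)) N≡1+M

  fromTour : ListCycle a b p q
  fromTour = record
    { squares = ws
    ; squares-length = length-applyUpTo (pos t) N
    ; size≥3 = atLeast3 t
    ; squares-unique = Unique-applyUpTo (pos t) N (injective t)
    ; squares-onBoard = All.applyUpTo⁺₁ (pos t) N (onBoard t _)
    ; squares-adjacent = adjacent
    ; closing-adjacent = subst (λ xs → Adj a b (final xs) (first xs)) (sym ws≡)
        (subst (λ z → Adj a b z (pos t 0)) (sym (final-applyUpTo (pos t) M)) (close t))
    }
    where
    adjacent : ∀ {u v} → Consecutive u v ws → Adj a b u v
    adjacent h with Consecutive-applyUpTo⁻ (pos t) N h
    ... | k , lt , refl , refl = step t k lt

  Consec⇒CycleEdge : ∀ {u v} → Consec t u v → CycleEdge ws u v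
  Consec⇒CycleEdge (inj₁ (i , lt , refl , refl)) = inj₁ (Consecutive-applyUpTo⁺ (pos t) N i lt)
  Consec⇒CycleEdge (inj₂ (refl , refl)) =
    inj₂ (subst (λ xs → final xs ≡ pos t M × first xs ≡ pos t 0) (sym ws≡) (final-applyUpTo (pos t) M , refl))

module _ {a b p q : ℕ} (c : ListCycle a b p q) {x y : Sq} {xs ys : List Sq}
         (split : squares c ≡ (x ∷ xs) ++ y ∷ ys) where
  private
    front : List Sq
    front = x ∷ xs
    back : List Sq
    back = y ∷ ys

    adjacent : ∀ {u v} → Consecutive u v (front ++ back) → Adj a b u v
    adjacent h = squares-adjacent c (subst (Consecutive _ _) (sym split) h)

    closing : Adj a b (final back) x
    closing = subst (λ z → Adj a b z x) (final-++ front y ys)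
      (subst (λ ws → Adj a b (final ws) (first ws)) split (closing-adjacent c))

  rotate : ListCycle a b p q
  rotate = record
    { squares = back ++ front
    ; squares-length = trans (length-++ back) (trans (+-comm (length back) (length front))
        (trans (sym (length-++ front)) (trans (cong length (sym split)) (squares-length c))))
    ; size≥3 = size≥3 c
    ; squares-unique = PermutationSetoid.Unique-resp-↭ (setoid Sq) (PermutationSetoid.++-comm (setoid Sq) front back)
        (subst Unique split (squares-unique c))
    ; squares-onBoard = let (onFront , onBack) = All.++⁻ front (subst (All _) split (squares-onBoard c))
                        in All.++⁺ onBack onFront
    ; squares-adjacent = adjacent′
    ; closing-adjacent = subst (λ z → Adj a b z y) (sym (final-++ back x xs)) (adjacent (Consecutive-join x xs y ys))
    }
    where
    adjacent′ : ∀ {u v} → Consecutive u v (back ++ front) → Adj a b u v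
    adjacent′ h with Consecutive-++⁻ back front h
    ... | inj₁ h′ = adjacent (Consecutive-++ʳ front h′)
    ... | inj₂ (inj₁ h′) = adjacent (Consecutive-++ˡ back h′)
    ... | inj₂ (inj₂ (refl , refl)) = closing

  rotate-keeps : ∀ {u v} → CycleEdge (front ++ back) u v → ¬ (u ≡ final front × v ≡ y) →
    Consecutive u v (back ++ front)
  rotate-keeps (inj₁ h) cut with Consecutive-++⁻ front back h
  ... | inj₁ h′ = Consecutive-++ʳ back h′
  ... | inj₂ (inj₁ h′) = Consecutive-++ˡ front h′
  ... | inj₂ (inj₂ (e₁ , e₂)) = ⊥-elim (cut (sym e₁ , sym e₂))
  rotate-keeps (inj₂ (refl , refl)) cut =
    subst (λ z → Consecutive z x (back ++ front)) (sym (final-++ front y ys)) (Consecutive-join y ys x xs)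

record CutAt {a b p q : ℕ} (c : ListCycle a b p q) (u v : Sq) : Set where
  field
    path       : ListCycle a b p q
    path-first : first (squares path) ≡ v
    path-final : final (squares path) ≡ u
    path-keeps : ∀ {u′ v′} → CycleEdge (squares c) u′ v′ → ¬ (u′ ≡ u × v′ ≡ v) →
                 Consecutive u′ v′ (squares path)

cutAt : ∀ {a b p q u v} (c : ListCycle a b p q) → CycleEdge (squares c) u v → CutAt c u v
cutAt c (inj₂ (refl , refl)) = record
  { path = c ; path-first = refl ; path-final = refl ; path-keeps = keeps }
  where
  keeps : ∀ {u′ v′} → CycleEdge (squares c) u′ v′ → ¬ (u′ ≡ final (squares c) × v′ ≡ first (squares c)) →
          Consecutive u′ v′ (squares c)
  keeps (inj₁ h) _ = h
  keeps (inj₂ (e₁ , e₂)) cut = ⊥-elim (cut (sym e₁ , sym e₂))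
cutAt c (inj₁ h) with Consecutive-split (squares c) h
... | x , xs , ys , split , final≡ = record
  { path = rotate c split
  ; path-first = refl
  ; path-final = trans (final-++ (_ ∷ ys) x xs) final≡
  ; path-keeps = λ e cut → rotate-keeps c split (subst (λ ws → CycleEdge ws _ _) split e)
                              (λ { (e₁ , e₂) → cut (trans e₁ final≡ , e₂) })
  }


Adj-sym : ∀ {a b} u v → Adj a b u v → Adj a b v u
Adj-sym (x , y) (x′ , y′) (inj₁ (e₁ , e₂)) = inj₁ (trans (∣-∣-comm x′ x) e₁ , trans (∣-∣-comm y′ y) e₂)
Adj-sym (x , y) (x′ , y′) (inj₂ (e₁ , e₂)) = inj₂ (trans (∣-∣-comm x′ x) e₁ , trans (∣-∣-comm y′ y) e₂)

reverseCycle : ∀ {a b p q} → ListCycle a b p q → ListCycle a b p q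
reverseCycle c = record
  { squares = reverse (squares c)
  ; squares-length = trans (length-reverse (squares c)) (squares-length c)
  ; size≥3 = size≥3 c
  ; squares-unique = Unique-reverse (squares c) (squares-unique c)
  ; squares-onBoard = All-reverse (squares c) (squares-onBoard c)
  ; squares-adjacent = λ {u} {v} h → Adj-sym v u (squares-adjacent c (Consecutive-reverse⁻ (squares c) h))
  ; closing-adjacent = subst₂ (Adj _ _) (sym (final-reverse (squares c))) (sym (first-reverse (squares c)))
      (Adj-sym (final (squares c)) (first (squares c)) (closing-adjacent c))
  }

squares≢[] : ∀ {a b p q} (c : ListCycle a b p q) → squares c ≢ []
squares≢[] c e =
  1+n≰n (≤-trans (≤-trans (s≤s z≤n) (size≥3 c)) (≤-reflexive (trans (sym (squares-length c)) (cong length e))))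

shiftX : ℕ → Sq → Sq
shiftX p (x , y) = (p + x , y)

shiftX-injective : ∀ p {u v} → shiftX p u ≡ shiftX p v → u ≡ v
shiftX-injective p {x , y} {x′ , y′} e = cong₂ _,_ (+-cancelˡ-≡ p x x′ (cong proj₁ e)) (cong proj₂ e)

Adj-shiftX : ∀ {a b} p u v → Adj a b u v → Adj a b (shiftX p u) (shiftX p v)
Adj-shiftX p (x , y) (x′ , y′) (inj₁ (e₁ , e₂)) = inj₁ (trans (∣m+n-m+o∣≡∣n-o∣ p x x′) e₁ , e₂)
Adj-shiftX p (x , y) (x′ , y′) (inj₂ (e₁ , e₂)) = inj₂ (trans (∣m+n-m+o∣≡∣n-o∣ p x x′) e₁ , e₂)

-- The closing edges of both cycles are replaced by join₁ and join₂.
module _ {a b p p′ q : ℕ} (left : ListCycle a b p q) (right : ListCycle a b p′ q)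
  (join₁ : Adj a b (final (squares left)) (shiftX p (first (squares right))))
  (join₂ : Adj a b (shiftX p (final (squares right))) (first (squares left))) where
  private
    ls : List Sq
    ls = squares left
    rs : List Sq
    rs = map (shiftX p) (squares right)

    disjoint : ∀ {w} → w ∈ ls × w ∈ rs → ⊥
    disjoint (w∈ls , w∈rs) with ∈-map⁻ (shiftX p) w∈rs
    ... | (x , y) , _ , refl = ≤⇒≯ (m≤m+n p x) (proj₁ (All.lookup (squares-onBoard left) w∈ls))

    onBoard-left : All (OnBoard (p + p′) q) ls
    onBoard-left = All.map (λ { {x , y} (x<p , y<q) → <-≤-trans x<p (m≤m+n p p′) , y<q }) (squares-onBoard left)

    onBoard-right : All (OnBoard (p + p′) q) rs
    onBoard-right = All.map⁺ (All.map (λ { {x , y} (x<p′ , y<q) → +-monoʳ-< p x<p′ , y<q }) (squares-onBoard right))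

    adjacent : ∀ {u v} → Consecutive u v (ls ++ rs) → Adj a b u v
    adjacent h with Consecutive-++⁻ ls rs h
    ... | inj₁ h′ = squares-adjacent left h′
    ... | inj₂ (inj₁ h′) with Consecutive-map⁻ (shiftX p) (squares right) h′
    ...   | u′ , v′ , h″ , refl , refl = Adj-shiftX p u′ v′ (squares-adjacent right h″)
    adjacent h | inj₂ (inj₂ (refl , refl)) =
      subst (Adj a b (final ls)) (sym (first-map (shiftX p) (squares right) (squares≢[] right))) join₁

  glue : ListCycle a b (p + p′) q
  glue = record
    { squares = ls ++ rs
    ; squares-length = trans (length-++ ls) (trans (cong₂ _+_ (squares-length left)
        (trans (length-map (shiftX p) (squares right)) (squares-length right))) (sym (*-distribʳ-+ q p p′)))
    ; size≥3 = ≤-trans (size≥3 left) (*-monoˡ-≤ q (m≤m+n p p′))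
    ; squares-unique = Unique.++⁺ (squares-unique left)
        (Unique.map⁺ (shiftX-injective p) (squares-unique right)) disjoint
    ; squares-onBoard = All.++⁺ onBoard-left onBoard-right
    ; squares-adjacent = adjacent
    ; closing-adjacent = subst₂ (Adj a b)
        (sym (trans (final-++′ ls rs (map≢[] (shiftX p) (squares≢[] right)))
                    (final-map (shiftX p) (squares right) (squares≢[] right))))
        (sym (first-++ ls rs (squares≢[] left))) join₂
    }

  glue-keeps : ∀ {u v} → Consecutive u v (squares right) → Consecutive (shiftX p u) (shiftX p v) (squares glue)
  glue-keeps h = Consecutive-++ʳ ls (Consecutive-map⁺ (shiftX p) (squares right) h)

Neighbours : Sq → Sq → List Sq → Set
Neighbours u v ws = Consecutive u v ws ⊎ Consecutive v u ws

-- The tour t with its edge u–v removed, as a Hamiltonian path from u to v.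
record OpenedAt {a b p q : ℕ} (t : Tour a b p q) (u v : Sq) : Set where
  field
    path       : ListCycle a b p q
    path-first : first (squares path) ≡ u
    path-final : final (squares path) ≡ v
    path-keeps : ∀ {u′ v′} → HasEdge t u′ v′ → u′ ≢ u → u′ ≢ v → Neighbours u′ v′ (squares path)

openAt : ∀ {a b p q u v} (t : Tour a b p q) → HasEdge t u v → OpenedAt t u v
openAt {u = u} {v} t (inj₂ c) = record
  { path = CutAt.path cut
  ; path-first = CutAt.path-first cut
  ; path-final = CutAt.path-final cut
  ; path-keeps = keeps
  }
  where
  cut : CutAt (fromTour t) v u
  cut = cutAt (fromTour t) (Consec⇒CycleEdge t c)
  keeps : ∀ {u′ v′} → HasEdge t u′ v′ → u′ ≢ u → u′ ≢ v → Neighbours u′ v′ (squares (CutAt.path cut))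
  keeps (inj₁ c′) _ u′≢v = inj₁ (CutAt.path-keeps cut (Consec⇒CycleEdge t c′) (λ (e , _) → u′≢v e))
  keeps (inj₂ c′) u′≢u _ = inj₂ (CutAt.path-keeps cut (Consec⇒CycleEdge t c′) (λ (_ , e) → u′≢u e))
openAt {u = u} {v} t (inj₁ c) = record
  { path = reverseCycle (CutAt.path cut)
  ; path-first = trans (first-reverse (squares (CutAt.path cut))) (CutAt.path-final cut)
  ; path-final = trans (final-reverse (squares (CutAt.path cut))) (CutAt.path-first cut)
  ; path-keeps = keeps
  }
  where
  cut : CutAt (fromTour t) u v
  cut = cutAt (fromTour t) (Consec⇒CycleEdge t c)
  ws : List Sq
  ws = squares (CutAt.path cut)
  keeps : ∀ {u′ v′} → HasEdge t u′ v′ → u′ ≢ u → u′ ≢ v → Neighbours u′ v′ (reverse ws)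
  keeps (inj₁ c′) u′≢u _ =
    inj₂ (Consecutive-reverse ws (CutAt.path-keeps cut (Consec⇒CycleEdge t c′) (λ (e , _) → u′≢u e)))
  keeps (inj₂ c′) _ u′≢v =
    inj₁ (Consecutive-reverse ws (CutAt.path-keeps cut (Consec⇒CycleEdge t c′) (λ (_ , e) → u′≢v e)))

∣-∣-balance : ∀ u u′ x x′ → u + x ≡ u′ + x′ → ∣ u - u′ ∣ ≡ ∣ x - x′ ∣
∣-∣-balance zero zero x x′ e = sym (trans (cong (∣_- x′ ∣) e) (∣n-n∣≡0 x′))
∣-∣-balance zero (suc u′) x x′ e =
  trans (sym (∣m-m+n∣≡n x′ (suc u′)))
        (trans (cong (∣ x′ -_∣) (trans (+-comm x′ (suc u′)) (sym e))) (∣-∣-comm x′ x))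
∣-∣-balance (suc u) zero x x′ e = trans (sym (∣m-m+n∣≡n x (suc u))) (cong (∣ x -_∣) (trans (+-comm x (suc u)) e))
∣-∣-balance (suc u) (suc u′) x x′ e = ∣-∣-balance u u′ x x′ (suc-injective e)

m+n≡o⇒∣m-o∣≡n : ∀ {m n o} → m + n ≡ o → ∣ m - o ∣ ≡ n
m+n≡o⇒∣m-o∣≡n {m} {n} refl = ∣m-m+n∣≡n m n

[m∸1]∸[n∸1]≡m∸n : ∀ m {n} → 0 < n → (m ∸ 1) ∸ (n ∸ 1) ≡ m ∸ n
[m∸1]∸[n∸1]≡m∸n m 0<n = trans (∸-+-assoc m 1 _) (cong (m ∸_) (m+[n∸m]≡n 0<n))

shiftX-flip : ∀ p p′ x → x < p′ → p + ((p′ ∸ 1) ∸ x) ≡ ((p + p′) ∸ 1) ∸ x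
shiftX-flip p (suc p′) x (s≤s x≤p′) =
  trans (sym (+-∸-assoc p x≤p′)) (cong (λ z → (z ∸ 1) ∸ x) (sym (+-suc p p′)))

flipIf-< : ∀ f p x → x < p → flipIf f p x < p
flipIf-< false p x lt = lt
flipIf-< true (suc p) x lt = s≤s (m∸n≤m p x)

flipIf-involutive : ∀ f p x → x < p → flipIf f p (flipIf f p x) ≡ x
flipIf-involutive false p x lt = refl
flipIf-involutive true (suc p) x (s≤s lt) = m∸[m∸n]≡n lt

∣flipIf-flipIf∣ : ∀ f p x x′ → x < p → x′ < p → ∣ flipIf f p x - flipIf f p x′ ∣ ≡ ∣ x - x′ ∣
∣flipIf-flipIf∣ false p x x′ _ _ = refl
∣flipIf-flipIf∣ true (suc p) x x′ (s≤s l) (s≤s l′) =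
  ∣-∣-balance (p ∸ x) (p ∸ x′) x x′ (trans (m∸n+n≡m l) (sym (m∸n+n≡m l′)))

Adj-swap : ∀ {a b} u v → Adj a b u v → Adj a b (swap u) (swap v)
Adj-swap (x , y) (x′ , y′) (inj₁ (e₁ , e₂)) = inj₂ (e₂ , e₁)
Adj-swap (x , y) (x′ , y′) (inj₂ (e₁ , e₂)) = inj₁ (e₂ , e₁)

reflectSq : (p q : ℕ) → Bool → Bool → Sq → Sq
reflectSq p q fx fy = act {p} {q} (refl-only fx fy)

module _ {p q : ℕ} (fx fy : Bool) where

  reflectSq-onBoard : ∀ {u} → OnBoard p q u → OnBoard p q (reflectSq p q fx fy u)
  reflectSq-onBoard {x , y} (x< , y<) = flipIf-< fx p x x< , flipIf-< fy q y y<

  reflectSq-involutive : ∀ {u} → OnBoard p q u → reflectSq p q fx fy (reflectSq p q fx fy u) ≡ u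
  reflectSq-involutive {x , y} (x< , y<) = cong₂ _,_ (flipIf-involutive fx p x x<) (flipIf-involutive fy q y y<)

  reflectSq-injective : ∀ {u v} → OnBoard p q u → OnBoard p q v → reflectSq p q fx fy u ≡ reflectSq p q fx fy v → u ≡ v
  reflectSq-injective ou ov e =
    trans (sym (reflectSq-involutive ou)) (trans (cong (reflectSq p q fx fy) e) (reflectSq-involutive ov))

  Adj-reflectSq : ∀ {a b u v} → OnBoard p q u → OnBoard p q v → Adj a b u v →
    Adj a b (reflectSq p q fx fy u) (reflectSq p q fx fy v)
  Adj-reflectSq {u = x , y} {x′ , y′} (x< , y<) (x′< , y′<) (inj₁ (e₁ , e₂)) =
    inj₁ (trans (∣flipIf-flipIf∣ fx p x x′ x< x′<) e₁ , trans (∣flipIf-flipIf∣ fy q y y′ y< y′<) e₂)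
  Adj-reflectSq {u = x , y} {x′ , y′} (x< , y<) (x′< , y′<) (inj₂ (e₁ , e₂)) =
    inj₂ (trans (∣flipIf-flipIf∣ fx p x x′ x< x′<) e₁ , trans (∣flipIf-flipIf∣ fy q y y′ y< y′<) e₂)

module _ {a b p q p′ q′ : ℕ} (f : Sq → Sq) (size : p * q ≡ p′ * q′)
  (f-onBoard : ∀ {u} → OnBoard p q u → OnBoard p′ q′ (f u))
  (f-injective : ∀ {u v} → OnBoard p q u → OnBoard p q v → f u ≡ f v → u ≡ v)
  (Adj-f : ∀ {u v} → OnBoard p q u → OnBoard p q v → Adj a b u v → Adj a b (f u) (f v))
  (t : Tour a b p q) where
  private
    N : ℕ
    N = p * q
    <N : ∀ {i} → i < p′ * q′ → i < N
    <N {i} = subst (i <_) (sym size)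
    0<N : 0 < N
    0<N = ≤-trans (s≤s z≤n) (atLeast3 t)

  mapTour : Tour a b p′ q′
  mapTour = record
    { atLeast3 = subst (3 ≤_) size (atLeast3 t)
    ; pos = λ i → f (pos t i)
    ; onBoard = λ i lt → f-onBoard (onBoard t i (<N lt))
    ; injective = λ i j li lj e →
        injective t i j (<N li) (<N lj) (f-injective (onBoard t i (<N li)) (onBoard t j (<N lj)) e)
    ; step = λ i lt → Adj-f (onBoard t i (<-trans (n<1+n i) (<N lt))) (onBoard t (suc i) (<N lt)) (step t i (<N lt))
    ; close = subst (λ n → Adj a b (f (pos t (n ∸ 1))) (f (pos t 0))) size
        (Adj-f (onBoard t (N ∸ 1) (≤-reflexive (m+[n∸m]≡n 0<N))) (onBoard t 0 0<N) (close t))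
    }

  Consec-mapTour : ∀ {u v} → Consec t u v → Consec mapTour (f u) (f v)
  Consec-mapTour (inj₁ (i , lt , refl , refl)) = inj₁ (i , subst (suc i <_) size lt , refl , refl)
  Consec-mapTour (inj₂ (refl , refl)) = inj₂ (cong (λ n → f (pos t (n ∸ 1))) (sym size) , refl)

  HasEdge-mapTour : ∀ {u v} → HasEdge t u v → HasEdge mapTour (f u) (f v)
  HasEdge-mapTour (inj₁ c) = inj₁ (Consec-mapTour c)
  HasEdge-mapTour (inj₂ c) = inj₂ (Consec-mapTour c)

HasEdge-sym : ∀ {a b p q} (t : Tour a b p q) {u v} → HasEdge t u v → HasEdge t v u
HasEdge-sym t (inj₁ c) = inj₂ c
HasEdge-sym t (inj₂ c) = inj₁ c

reflectTour : ∀ {a b p q} → Bool → Bool → Tour a b p q → Tour a b p q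
reflectTour {p = p} {q} fx fy =
  mapTour (reflectSq p q fx fy) refl (reflectSq-onBoard fx fy) (reflectSq-injective fx fy) (Adj-reflectSq fx fy)

HasEdge-reflectTour : ∀ {a b p q} fx fy (t : Tour a b p q) {u v} → HasEdge t u v →
  HasEdge (reflectTour fx fy t) (reflectSq p q fx fy u) (reflectSq p q fx fy v)
HasEdge-reflectTour {p = p} {q} fx fy =
  HasEdge-mapTour (reflectSq p q fx fy) refl (reflectSq-onBoard fx fy) (reflectSq-injective fx fy) (Adj-reflectSq fx fy)

transposeTour : ∀ {a b p q} → Tour a b p q → Tour a b q p
transposeTour {p = p} {q} = mapTour swap (*-comm p q) (λ (x< , y<) → y< , x<) (λ _ _ → cong swap) (λ {u} {v} _ _ → Adj-swap u v)

HasEdge-transposeTour : ∀ {a b p q} (t : Tour a b p q) {u v} → HasEdge t u v → HasEdge (transposeTour t) (swap u) (swap v)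
HasEdge-transposeTour {p = p} {q} =
  HasEdge-mapTour swap (*-comm p q) (λ (x< , y<) → y< , x<) (λ _ _ → cong swap) (λ {u} {v} _ _ → Adj-swap u v)


injective⇒surjective : ∀ {n} (f : Fin n → Fin n) → Injective _≡_ _≡_ f → ∀ k → ∃[ i ] f i ≡ k
injective⇒surjective {zero} f inj ()
injective⇒surjective {suc n} f inj k with Fin.any? (λ i → f i Fin.≟ k)
... | yes hit = hit
... | no miss = ⊥-elim (1+n≰n (Fin.injective⇒≤ g-injective))
  where
  k≢f : ∀ i → k ≢ f i
  k≢f i e = miss (i , sym e)
  g : Fin (suc n) → Fin n
  g i = punchOut (k≢f i)
  g-injective : Injective _≡_ _≡_ g
  g-injective e = inj (Fin.punchOut-injective (k≢f _) (k≢f _) e)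

module _ {a b p q : ℕ} (t : Tour a b p q) where
  private
    N : ℕ
    N = p * q
    0<N : 0 < N
    0<N = ≤-trans (s≤s z≤n) (atLeast3 t)
    N≡1+[N∸1] : N ≡ suc (N ∸ 1)
    N≡1+[N∸1] = sym (m+[n∸m]≡n 0<N)

    encode : ∀ {u} → OnBoard p q u → Fin N
    encode (x< , y<) = combine (fromℕ< x<) (fromℕ< y<)

    encode-injective : ∀ {u v} (ou : OnBoard p q u) (ov : OnBoard p q v) → encode ou ≡ encode ov → u ≡ v
    encode-injective (x< , y<) (x′< , y′<) e =
      let (e₁ , e₂) = Fin.combine-injective (fromℕ< x<) (fromℕ< y<) (fromℕ< x′<) (fromℕ< y′<) e
      in cong₂ _,_ (Fin.fromℕ<-injective _ _ x< x′< e₁) (Fin.fromℕ<-injective _ _ y< y′< e₂)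

  visits : ∀ {u} → OnBoard p q u → ∃[ i ] (i < N × pos t i ≡ u)
  visits ou with injective⇒surjective f f-injective (encode ou)
    where
    onBoard′ : (i : Fin N) → OnBoard p q (pos t (toℕ i))
    onBoard′ i = onBoard t _ (Fin.toℕ<n i)
    f : Fin N → Fin N
    f i = encode (onBoard′ i)
    f-injective : Injective _≡_ _≡_ f
    f-injective {i} {j} e = Fin.toℕ-injective
      (injective t _ _ (Fin.toℕ<n i) (Fin.toℕ<n j) (encode-injective (onBoard′ i) (onBoard′ j) e))
  ... | i , e = toℕ i , Fin.toℕ<n i , encode-injective (onBoard t _ (Fin.toℕ<n i)) ou e

  Consec⇒Adj : ∀ {u v} → Consec t u v → Adj a b u v
  Consec⇒Adj (inj₁ (i , lt , refl , refl)) = step t i lt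
  Consec⇒Adj (inj₂ (refl , refl)) = close t

  successor-and-predecessor : ∀ i → i < N → ∃[ j ] ∃[ k ] (j < N × k < N × j ≢ k ×
    Consec t (pos t i) (pos t j) × Consec t (pos t k) (pos t i))
  successor-and-predecessor zero _ = 1 , N ∸ 1 , 1<N , ≤-reflexive (sym N≡1+[N∸1]) , 1≢N∸1 ,
      inj₁ (0 , 1<N , refl , refl) , inj₂ (refl , refl)
    where
    1<N : 1 < N
    1<N = <-≤-trans (s≤s (s≤s z≤n)) (atLeast3 t)
    1≢N∸1 : 1 ≢ N ∸ 1
    1≢N∸1 e = <-irrefl refl (≤-trans (atLeast3 t) (≤-reflexive (trans N≡1+[N∸1] (cong suc (sym e)))))
  successor-and-predecessor (suc i) lt with suc (suc i) <? N
  ... | yes 2+i<N = suc (suc i) , i , 2+i<N , <-trans (n<1+n i) lt , (λ e → <-irrefl (sym e) (m<n+m i (s≤s z≤n))) ,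
                    inj₁ (suc i , 2+i<N , refl , refl) , inj₁ (i , lt , refl , refl)
  ... | no 2+i≮N = 0 , i , 0<N , <-trans (n<1+n i) lt , 0≢i ,
                   inj₂ (cong (pos t) (sym 1+i≡N∸1) , refl) , inj₁ (i , lt , refl , refl)
    where
    1+i≡N∸1 : suc i ≡ N ∸ 1
    1+i≡N∸1 = suc-injective (≤-antisym (≤-trans lt (≤-reflexive N≡1+[N∸1]))
                                       (≤-trans (≤-reflexive (sym N≡1+[N∸1])) (≮⇒≥ 2+i≮N)))
    0≢i : 0 ≢ i
    0≢i refl = <-irrefl refl (≤-trans (atLeast3 t) (≤-reflexive (trans N≡1+[N∸1] (cong suc (sym 1+i≡N∸1)))))

  HasEdge-of-degree≤2 : ∀ {c w₁ w₂} → OnBoard p q c →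
    (∀ {w} → OnBoard p q w → Adj a b c w → w ≡ w₁ ⊎ w ≡ w₂) → HasEdge t c w₂
  HasEdge-of-degree≤2 oc nbrs with visits oc
  ... | i , i<N , refl with successor-and-predecessor i i<N
  ... | j , k , j<N , k<N , j≢k , cj , ck
    with nbrs (onBoard t j j<N) (Consec⇒Adj cj) | nbrs (onBoard t k k<N) (Adj-sym (pos t k) (pos t i) (Consec⇒Adj ck))
  ... | inj₂ refl | _ = inj₁ cj
  ... | inj₁ _ | inj₂ refl = inj₂ ck
  ... | inj₁ e₁ | inj₁ e₂ = ⊥-elim (j≢k (injective t j k j<N k<N (trans e₁ (sym e₂))))

  cornerEdge : ∀ fx fy → OnBoard p q (0 , 0) → HasEdge t (reflectSq p q fx fy (0 , 0)) (reflectSq p q fx fy (b , a))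
  cornerEdge fx fy o = HasEdge-of-degree≤2 (reflectSq-onBoard fx fy o) neighbours
    where
    Adj-origin : ∀ {z} → Adj a b (0 , 0) z → z ≡ (a , b) ⊎ z ≡ (b , a)
    Adj-origin (inj₁ (refl , refl)) = inj₁ refl
    Adj-origin (inj₂ (refl , refl)) = inj₂ refl
    neighbours : ∀ {w} → OnBoard p q w → Adj a b (reflectSq p q fx fy (0 , 0)) w →
      w ≡ reflectSq p q fx fy (a , b) ⊎ w ≡ reflectSq p q fx fy (b , a)
    neighbours {w} ow adj
      with Adj-origin (subst (λ z → Adj a b z (reflectSq p q fx fy w)) (reflectSq-involutive fx fy o)
                        (Adj-reflectSq fx fy (reflectSq-onBoard fx fy o) ow adj))
    ... | inj₁ e = inj₁ (trans (sym (reflectSq-involutive fx fy ow)) (cong (reflectSq p q fx fy) e))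
    ... | inj₂ e = inj₂ (trans (sym (reflectSq-involutive fx fy ow)) (cong (reflectSq p q fx fy) e))

ReflectedEdge : ∀ {a b p q} → Tour a b p q → Sq → Sq → Set
ReflectedEdge {p = p} {q} t u v =
  Σ[ fx ∈ Bool ] Σ[ fy ∈ Bool ] HasEdge t (reflectSq p q fx fy u) (reflectSq p q fx fy v)

-- Link base edges lie near the origin, so their images reflected in x lie at the right-hand side.
RightEdge : ∀ {a b p q} → Tour a b p q → Sq → Sq → Set
RightEdge {p = p} {q} t u v = Σ[ fy ∈ Bool ] HasEdge t (reflectSq p q true fy u) (reflectSq p q true fy v)

module _ {a b p q : ℕ} where

  ReflectedEdge⇒RightEdge : ∀ (t : Tour a b p q) {u v} → ReflectedEdge t u v → Σ[ t′ ∈ Tour a b p q ] RightEdge t′ u v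
  ReflectedEdge⇒RightEdge t (true , fy , e) = t , fy , e
  ReflectedEdge⇒RightEdge t (false , fy , e) = reflectTour true false t , fy , HasEdge-reflectTour true false t e

  ReflectedEdge-transpose : ∀ (t : Tour a b p q) {u v} → ReflectedEdge t u v →
    ReflectedEdge (transposeTour t) (swap u) (swap v)
  ReflectedEdge-transpose t (fx , fy , e) = fy , fx , HasEdge-transposeTour t e

  HasLink⇒ReflectedEdge : ∀ (t : Tour a b p q) {u v} → HasLink t u v →
    ReflectedEdge t u v ⊎ (p ≡ q × ReflectedEdge t (swap u) (swap v))
  HasLink⇒ReflectedEdge t (_ , _ , refl-only fx fy , e) = inj₁ (fx , fy , e)
  HasLink⇒ReflectedEdge t (_ , _ , transp p≡q fx fy , e) = inj₂ (p≡q , fx , fy , e)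

  ReflectedEdge⇒HasLink : ∀ (t : Tour a b p q) {u v} → OnBoard p q u → OnBoard p q v → ReflectedEdge t u v → HasLink t u v
  ReflectedEdge⇒HasLink t ou ov (fx , fy , e) = ou , ov , refl-only fx fy , e

Representable : ℕ → ℕ → ℕ → Set
Representable m n k = ∃[ i ] ∃[ j ] i * m + j * n ≡ k

Representable-swap : ∀ {m n k} → Representable n m k → Representable m n k
Representable-swap {m} {n} (i , j , e) = j , i , trans (+-comm (j * m) (i * n)) e

-- Divide d by m′ as d = r + t m′ and put s = m′ − 1 − r; then the Bézout relation
-- g + y n = x m with m = m′ g gives g d + (m′ − 1) y n = (r x + t) m + (s y) n.
Representable-Bézout : ∀ {m n g m′ x y} .{{_ : NonZero m′}} → m ≡ m′ * g → g + y * n ≡ x * m →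
  ∀ d → Representable m n (g * d + (m′ ∸ 1) * (y * n))
Representable-Bézout {m} {n} {g} {m′} {x} {y} refl bézout d = r * x + t , s * y , (begin
  (r * x + t) * m + s * y * n           ≡⟨ expand r x t m s y n ⟩
  r * (x * m) + t * m + s * y * n       ≡⟨ cong (λ z → r * z + t * m + s * y * n) (sym bézout) ⟩
  r * (g + y * n) + t * m + s * y * n   ≡⟨ collect r g y n t m′ s ⟩
  g * (r + t * m′) + (s + r) * (y * n)
    ≡⟨ cong₂ (λ z w → g * z + w * (y * n)) (sym (m≡m%n+[m/n]*n d m′)) s+r≡m′∸1 ⟩
  g * d + (m′ ∸ 1) * (y * n)            ∎)
  where
  r : ℕ
  r = d % m′
  t : ℕ
  t = d / m′
  s : ℕ
  s = (m′ ∸ 1) ∸ r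
  s+r≡m′∸1 : s + r ≡ m′ ∸ 1
  s+r≡m′∸1 = m∸n+n≡m (<⇒≤pred (m%n<n d m′))
  expand : ∀ r x t m s y n → (r * x + t) * m + s * y * n ≡ r * (x * m) + t * m + s * y * n
  expand = solve-∀
  collect : ∀ r g y n t m′ s → r * (g + y * n) + t * (m′ * g) + s * y * n ≡ g * (r + t * m′) + (s + r) * (y * n)
  collect = solve-∀

gcd[m,m]≡m : ∀ m → gcd m m ≡ m
gcd[m,m]≡m m = ∣-antisym (gcd[m,n]∣m m m) (gcd-greatest ∣-refl ∣-refl)

gcd[m,n]≢m⇒m≢n : ∀ {m n} → gcd m n ≢ m → m ≢ n
gcd[m,n]≢m⇒m≢n {m} gcd≢m refl = gcd≢m (gcd[m,m]≡m m)

multiples-above : ∀ {g K} (P : ℕ → Set) → g ∣ K → (∀ d → P (g * d + K)) → ∀ k → g ∣ k → K ≤ k → P k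
multiples-above {g} {K} P g∣K P[gd+K] k g∣k K≤k with ∣m+n∣m⇒∣n (subst (g ∣_) (sym (m+[n∸m]≡n K≤k)) g∣k) g∣K
... | divides d k∸K≡d*g = subst P (begin
  g * d + K        ≡⟨ cong (_+ K) (trans (*-comm g d) (sym k∸K≡d*g)) ⟩
  k ∸ K + K        ≡⟨ m∸n+n≡m K≤k ⟩
  k                ∎) (P[gd+K] d)

module _ {m n : ℕ} (0<m : 0 < m) (0<n : 0 < n) where
  private
    g : ℕ
    g = gcd m n

    cofactor : ∀ {k} → 0 < k → g ∣ k → Σ[ k′ ∈ ℕ ] (NonZero k′ × k ≡ k′ * g)
    cofactor 0<k (divides zero k≡0) = ⊥-elim (<⇒≢ 0<k (sym k≡0))
    cofactor 0<k (divides (suc k′) k≡) = suc k′ , _ , k≡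

  Representable-multiples-of-gcd : ∃[ K ] ∀ k → gcd m n ∣ k → K ≤ k → Representable m n k
  Representable-multiples-of-gcd with Bézout.identity (gcd-GCD m n)
  ... | Bézout.+- x y bézout with cofactor 0<m (gcd[m,n]∣m m n)
  ...   | m′ , m′≢0 , m≡m′g = (m′ ∸ 1) * (y * n) ,
          multiples-above (Representable m n) (∣n⇒∣m*n (m′ ∸ 1) (∣n⇒∣m*n y (gcd[m,n]∣n m n)))
            (Representable-Bézout {x = x} {y} {{m′≢0}} m≡m′g bézout)
  Representable-multiples-of-gcd | Bézout.-+ x y bézout with cofactor 0<n (gcd[m,n]∣n m n)
  ...   | n′ , n′≢0 , n≡n′g = (n′ ∸ 1) * (x * m) ,
          multiples-above (Representable m n) (∣n⇒∣m*n (n′ ∸ 1) (∣n⇒∣m*n x (gcd[m,n]∣m m n)))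
            (λ d → Representable-swap (Representable-Bézout {x = y} {x} {{n′≢0}} n≡n′g bézout d))

module LinkGluing (a b : ℕ) (0<b : 0 < b) (b<a : b < a) where

  H₁ H₂ : Sq
  H₁ = (a ∸ 1 , b)
  H₂ = (a ∸ b ∸ 1 , a + b)

  private
    0<a : 0 < a
    0<a = <-trans 0<b b<a
    0<a∸b : 0 < a ∸ b
    0<a∸b = m<n⇒0<n∸m b<a

    Adj-flipY : ∀ {q} fy x₁ x₂ {y₁ y₂} → y₁ < q → y₂ < q → ∣ x₁ - x₂ ∣ ≡ a → ∣ y₁ - y₂ ∣ ≡ b →
      Adj a b (x₁ , flipIf fy q y₁) (x₂ , flipIf fy q y₂)
    Adj-flipY {q} fy x₁ x₂ {y₁} {y₂} y₁< y₂< ex ey =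
      inj₁ (ex , trans (∣flipIf-flipIf∣ fy q y₁ y₂ y₁< y₂<) ey)

  module _ {p p′ q : ℕ} (a+b<p : a + b < p) (0<p′ : 0 < p′) (a+b<q : a + b < q)
           (S : Tour a b p q) (fy : Bool) (S∋AB : HasEdge S (reflectSq p q true fy H₁) (reflectSq p q true fy H₂))
           (Q : Tour a b p′ q) where
    private
      a≤p : a ≤ p
      a≤p = ≤-trans (m≤m+n a b) (<⇒≤ a+b<p)
      A B X Y : Sq
      A = reflectSq p q true fy H₁
      B = reflectSq p q true fy H₂
      X = reflectSq p′ q false fy (0 , 0)
      Y = reflectSq p′ q false fy (b , a)

      b<q : b < q
      b<q = ≤-<-trans (m≤n+m b a) a+b<q
      a<q : a < q
      a<q = ≤-<-trans (m≤m+n a b) a+b<q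

      A~X : Adj a b A (shiftX p X)
      A~X = Adj-flipY fy ((p ∸ 1) ∸ (a ∸ 1)) (p + 0) b<q (≤-<-trans z≤n b<q)
        (m+n≡o⇒∣m-o∣≡n (trans (cong (_+ a) ([m∸1]∸[n∸1]≡m∸n p 0<a))
                              (trans (m∸n+n≡m a≤p) (sym (+-identityʳ p)))))
        (∣-∣-identityʳ b)

      B~Y : Adj a b B (shiftX p Y)
      B~Y = Adj-flipY fy ((p ∸ 1) ∸ (a ∸ b ∸ 1)) (p + b) a+b<q a<q
        (m+n≡o⇒∣m-o∣≡n (begin
          (p ∸ 1) ∸ (a ∸ b ∸ 1) + a   ≡⟨ cong (_+ a) ([m∸1]∸[n∸1]≡m∸n p 0<a∸b) ⟩
          p ∸ (a ∸ b) + a             ≡⟨ cong (p ∸ (a ∸ b) +_) (sym (m∸n+n≡m (<⇒≤ b<a))) ⟩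
          p ∸ (a ∸ b) + (a ∸ b + b)   ≡⟨ sym (+-assoc (p ∸ (a ∸ b)) (a ∸ b) b) ⟩
          p ∸ (a ∸ b) + (a ∸ b) + b   ≡⟨ cong (_+ b) (m∸n+n≡m (≤-trans (m∸n≤m a b) a≤p)) ⟩
          p + b                       ∎))
        (trans (∣-∣-comm (a + b) a) (∣m-m+n∣≡n a b))

      cutS : OpenedAt S B A
      cutS = openAt S (HasEdge-sym S S∋AB)
      cutQ : OpenedAt Q X Y
      cutQ = openAt Q (cornerEdge Q false fy (0<p′ , ≤-<-trans z≤n b<q))

      open OpenedAt

      join₁ : Adj a b (final (squares (path cutS))) (shiftX p (first (squares (path cutQ))))
      join₁ = subst₂ (λ u v → Adj a b u (shiftX p v)) (sym (path-final cutS)) (sym (path-first cutQ)) A~X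

      join₂ : Adj a b (shiftX p (final (squares (path cutQ)))) (first (squares (path cutS)))
      join₂ = subst₂ (λ u v → Adj a b (shiftX p u) v) (sym (path-final cutQ)) (sym (path-first cutS))
        (Adj-sym B (shiftX p Y) B~Y)

    gluedCycle : ListCycle a b (p + p′) q
    gluedCycle = glue (path cutS) (path cutQ) join₁ join₂

    glued : Tour a b (p + p′) q
    glued = toTour gluedCycle

    glued-keeps : ∀ {u v} → HasEdge Q u v → b < proj₁ u → HasEdge glued (shiftX p u) (shiftX p v)
    glued-keeps {u} e b<u with path-keeps cutQ e (λ { refl → <⇒≱ b<u z≤n }) (λ { refl → <-irrefl refl b<u })
    ... | inj₁ h = inj₁ (Consecutive⇒Consec gluedCycle (glue-keeps (path cutS) (path cutQ) join₁ join₂ h))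
    ... | inj₂ h = inj₂ (Consecutive⇒Consec gluedCycle (glue-keeps (path cutS) (path cutQ) join₁ join₂ h))

    RightEdge-glued : ∀ {u v} → b + suc (proj₁ u) < p′ → proj₁ v < p′ → RightEdge Q u v → RightEdge glued u v
    RightEdge-glued {ux , uy} {vx , vy} b+1+ux<p′ vx<p′ (fy′ , e) = fy′ ,
      subst₂ (HasEdge glued) (cong (_, flipIf fy′ q uy) (shiftX-flip p p′ ux ux<p′))
                             (cong (_, flipIf fy′ q vy) (shiftX-flip p p′ vx vx<p′))
        (glued-keeps e (m+n≤o⇒m≤o∸n (suc b) b+ux<p′∸1))
      where
      b+ux<p′∸1 : b + ux < p′ ∸ 1
      b+ux<p′∸1 = <⇒≤pred (subst (_< p′) (+-suc b ux) b+1+ux<p′)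
      ux<p′ : ux < p′
      ux<p′ = ≤-<-trans (m≤n+m ux b) (<-≤-trans b+ux<p′∸1 (m∸n≤m p′ 1))

  V₁ V₂ : Sq
  V₁ = swap H₁
  V₂ = swap H₂

  RightLinked : ℕ → ℕ → Set
  RightLinked p q = (Σ[ t ∈ Tour a b p q ] RightEdge t H₁ H₂) × (Σ[ t ∈ Tour a b p q ] RightEdge t V₁ V₂)

  RightLinked-+ : ∀ {p p′ q} → a + b < p → a + b < p′ → a + b < q →
    RightLinked p q → RightLinked p′ q → RightLinked (p + p′) q
  RightLinked-+ {p} {p′} a+b<p a+b<p′ a+b<q ((S , fy , S∋H) , _) ((QH , QH∋H) , (QV , QV∋V)) =
      (glued a+b<p 0<p′ a+b<q S fy S∋H QH , RightEdge-glued a+b<p 0<p′ a+b<q S fy S∋H QH b+a<p′ a∸b∸1<p′ QH∋H)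
    , (glued a+b<p 0<p′ a+b<q S fy S∋H QV , RightEdge-glued a+b<p 0<p′ a+b<q S fy S∋H QV b+1+b<p′ a+b<p′ QV∋V)
    where
    0<p′ : 0 < p′
    0<p′ = ≤-<-trans z≤n a+b<p′
    b+a<p′ : b + suc (a ∸ 1) < p′
    b+a<p′ = subst (λ z → b + z < p′) (sym (m+[n∸m]≡n 0<a)) (subst (_< p′) (+-comm a b) a+b<p′)
    a∸b∸1<p′ : a ∸ b ∸ 1 < p′
    a∸b∸1<p′ = ≤-<-trans (≤-trans (m∸n≤m (a ∸ b) 1) (m∸n≤m a b)) (≤-<-trans (m≤m+n a b) a+b<p′)
    b+1+b<p′ : b + suc b < p′
    b+1+b<p′ = ≤-<-trans (+-monoʳ-≤ b b<a) (subst (_< p′) (+-comm a b) a+b<p′)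

  RightLinked-from : ∀ {p q} (t t′ : Tour a b p q) →
    ReflectedEdge t H₁ H₂ → ReflectedEdge t′ V₁ V₂ → RightLinked p q
  RightLinked-from t t′ h v = ReflectedEdge⇒RightEdge t h , ReflectedEdge⇒RightEdge t′ v

  RightLinked-transpose : ∀ {p q} → RightLinked p q → RightLinked q p
  RightLinked-transpose ((t , h) , (t′ , v)) = RightLinked-from (transposeTour t′) (transposeTour t)
    (ReflectedEdge-transpose t′ (true , v)) (ReflectedEdge-transpose t (true , h))

  RightLinked-prepend : ∀ {w p q} → a + b < w → a + b < p → a + b < q → RightLinked w q → RightLinked p q →
    ∀ i → RightLinked (i * w + p) q
  RightLinked-prepend a+b<w a+b<p a+b<q Lw Lp zero = Lp
  RightLinked-prepend {w} {p} {q} a+b<w a+b<p a+b<q Lw Lp (suc i) =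
    subst (λ z → RightLinked z q) (sym (+-assoc w (i * w) p))
      (RightLinked-+ a+b<w (≤-trans a+b<p (m≤n+m p (i * w))) a+b<q Lw (RightLinked-prepend a+b<w a+b<p a+b<q Lw Lp i))

  RightLinked-combination : ∀ {w₁ w₂ q} → a + b < w₁ → a + b < w₂ → a + b < q → RightLinked w₁ q → RightLinked w₂ q →
    ∀ i j → 0 < i * w₁ + j * w₂ → RightLinked (i * w₁ + j * w₂) q
  RightLinked-combination {w₁} {w₂} {q} a+b<w₁ a+b<w₂ a+b<q L₁ L₂ i (suc j) _ =
    subst (λ z → RightLinked (i * w₁ + z) q) (+-comm (j * w₂) w₂)
      (RightLinked-prepend a+b<w₁ (≤-trans a+b<w₂ (m≤n+m w₂ (j * w₂))) a+b<q L₁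
        (RightLinked-prepend a+b<w₂ a+b<w₂ a+b<q L₂ L₂ j) i)
  RightLinked-combination {w₁} {q = q} a+b<w₁ a+b<w₂ a+b<q L₁ L₂ (suc i) zero _ =
    subst (λ z → RightLinked z q) (trans (+-comm (i * w₁) w₁) (sym (+-identityʳ (w₁ + i * w₁))))
      (RightLinked-prepend a+b<w₁ a+b<w₁ a+b<q L₁ L₁ i)
  RightLinked-combination _ _ _ _ _ zero zero ()

  V-onBoard : ∀ {p q} → a + b < p → a + b < q → OnBoard p q V₁ × OnBoard p q V₂
  V-onBoard a+b<p a+b<q = (≤-<-trans (m≤n+m b a) a+b<p , a∸1<) , (a+b<p , ≤-<-trans (m∸n≤m (a ∸ b) 1) a∸b<)
    where
    a∸b< : a ∸ b < _
    a∸b< = ≤-<-trans (≤-trans (m∸n≤m a b) (m≤m+n a b)) a+b<q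
    a∸1< : a ∸ 1 < _
    a∸1< = ≤-<-trans (≤-trans (m∸n≤m a 1) (m≤m+n a b)) a+b<q

  TourHV⇒a+b<sides : ∀ {p q} → TourHV a b p q → a + b < p × a + b < q
  TourHV⇒a+b<sides (_ , (_ , (_ , a+b<q) , _) , (_ , (a+b<p , _) , _)) = a+b<p , a+b<q

  TourHV⇒RightLinked : ∀ {p q} → p ≢ q → TourHV a b p q → RightLinked p q
  TourHV⇒RightLinked p≢q (t , h , v) with HasLink⇒ReflectedEdge t h | HasLink⇒ReflectedEdge t v
  ... | inj₁ h′ | inj₁ v′ = RightLinked-from t t h′ v′
  ... | inj₂ (p≡q , _) | _ = ⊥-elim (p≢q p≡q)
  ... | _ | inj₂ (p≡q , _) = ⊥-elim (p≢q p≡q)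

  HasLinkH⇒RightLinked : ∀ {n} (t : Tour a b n n) → HasLinkH t → RightLinked n n
  HasLinkH⇒RightLinked t h with HasLink⇒ReflectedEdge t h
  ... | inj₁ h′ = RightLinked-from t (transposeTour t) h′ (ReflectedEdge-transpose t h′)
  ... | inj₂ (_ , v′) = RightLinked-from (transposeTour t) t (ReflectedEdge-transpose t v′) v′

  RightLinked-representable : ∀ {w₁ w₂ k q} → a + b < w₁ → a + b < w₂ → a + b < k → a + b < q →
    RightLinked w₁ q → RightLinked w₂ q → Representable w₁ w₂ k → RightLinked k q
  RightLinked-representable a+b<w₁ a+b<w₂ a+b<k a+b<q L₁ L₂ (i , j , refl) =
    RightLinked-combination a+b<w₁ a+b<w₂ a+b<q L₁ L₂ i j (≤-<-trans z≤n a+b<k)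

  RightLinked-grid : ∀ {m n k l} → a + b < m → a + b < n → a + b < k → a + b < l →
    RightLinked m n → RightLinked n n → RightLinked m m → Representable m n k → Representable m n l → RightLinked l k
  RightLinked-grid {m} {n} {k} a+b<m a+b<n a+b<k a+b<l Lmn Lnn Lmm k≡ l≡ =
    RightLinked-representable a+b<m a+b<n a+b<l a+b<k (RightLinked-transpose Lkm) (RightLinked-transpose Lkn) l≡
    where
    Lkn : RightLinked k n
    Lkn = RightLinked-representable a+b<m a+b<n a+b<k a+b<n Lmn Lnn k≡
    Lkm : RightLinked k m
    Lkm = RightLinked-representable a+b<m a+b<n a+b<k a+b<m Lmm (RightLinked-transpose Lmn) k≡

  RightLinked⇒HasLinkV : ∀ {k l} → a + b < k → a + b < l → RightLinked l k → Σ[ t ∈ Tour a b k l ] HasLinkV t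
  RightLinked⇒HasLinkV {k} {l} a+b<k a+b<l ((T , T∋H) , _) = transposeTour T ,
    ReflectedEdge⇒HasLink (transposeTour T) V₁-on V₂-on (ReflectedEdge-transpose T (true , T∋H))
    where
    V₁-on : OnBoard k l V₁
    V₁-on = proj₁ (V-onBoard a+b<k a+b<l)
    V₂-on : OnBoard k l V₂
    V₂-on = proj₂ (V-onBoard a+b<k a+b<l)

lemma16 : (a b m n : ℕ) → 0 < b → b < a → 0 < m → 0 < n → gcd m n ≡ 2 →
    TourHV a b m n → TourHV a b n n → TourHV a b m m →
    ∃[ K ] ((k l : ℕ) → 2 ∣ k → 2 ∣ l → K ≤ k → K ≤ l →
      Σ[ t ∈ Tour a b k l ] HasLinkV t)
lemma16 a b m n 0<b b<a 0<m 0<n gcd≡2 Tmn (tn , hn , _) (tm , hm , _) = K , tour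
  where
  open LinkGluing a b 0<b b<a
  a+b<m : a + b < m
  a+b<m = proj₁ (TourHV⇒a+b<sides Tmn)
  a+b<n : a + b < n
  a+b<n = proj₂ (TourHV⇒a+b<sides Tmn)
  2<m : 2 < m
  2<m = ≤-trans (+-mono-≤ (≤-trans (s≤s 0<b) b<a) 0<b) (<⇒≤ a+b<m)
  Lmn : RightLinked m n
  Lmn = TourHV⇒RightLinked (gcd[m,n]≢m⇒m≢n (λ gcd≡m → <⇒≢ 2<m (trans (sym gcd≡2) gcd≡m))) Tmn
  K₀ K : ℕ
  K₀ = proj₁ (Representable-multiples-of-gcd 0<m 0<n)
  K = K₀ + suc (a + b)
  a+b< : ∀ {k} → K ≤ k → a + b < k
  a+b< K≤k = ≤-trans (m≤n+m (suc (a + b)) K₀) K≤k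
  representable : ∀ {k} → 2 ∣ k → K ≤ k → Representable m n k
  representable {k} 2∣k K≤k =
    proj₂ (Representable-multiples-of-gcd 0<m 0<n) k (subst (_∣ k) (sym gcd≡2) 2∣k) (≤-trans (m≤m+n K₀ _) K≤k)
  tour : (k l : ℕ) → 2 ∣ k → 2 ∣ l → K ≤ k → K ≤ l → Σ[ t ∈ Tour a b k l ] HasLinkV t
  tour k l 2∣k 2∣l K≤k K≤l = RightLinked⇒HasLinkV (a+b< K≤k) (a+b< K≤l)
    (RightLinked-grid a+b<m a+b<n (a+b< K≤k) (a+b< K≤l) Lmn (HasLinkH⇒RightLinked tn hn) (HasLinkH⇒RightLinked tm hm)
      (representable 2∣k K≤k) (representable 2∣l K≤l))
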